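{- Let $t>0$ be an integer and $0<\delta\le 1$, $c>0$ reals. Then there is a constant $c'>0$ (depending on $t,\delta,c$) such that for every $n$-vertex $K_{2,t}$-minor-free graph $G$ having a vertex $v_0$ of degree at least $c\,n^{\delta}$, every vertex-separating path system $\mathcal{P}$ of $G$ satisfies $|\mathcal{P}| \ge c'\, n^{\epsilon}$, where $\epsilon = \frac{\delta}{t+1}$.
   Context: All graphs are finite, simple, connected with at least 4 vertices. $G$ is $K_{2,t}$-minor-free if the complete bipartite graph $K_{2,t}$ cannot be obtained from $G$ by deleting vertices/edges and contracting edges. A path in $G$ is a sequence of distinct vertices $v_0,\dots,v_r$ ($r\ge0$) with consecutive vertices adjacent. A vertex-separating path system of $G$ is a collection of distinct paths in $G$ such that for every pair of distinct vertices $u,v$ some path in the collection contains exactly one of $u$ and $v$. -}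

module Defs where

open import Data.Nat using (ℕ; zero; suc; _+_; _*_; _^_; _≤_)
open import Data.Integer using (+_)
open import Data.Rational using (ℚ; _/_; _<_) renaming (_≤_ to _≤ℚ_)
open import Data.Bool using (Bool; true; false; T)
open import Data.Fin using (Fin)
open import Data.List using (List; []; _∷_; length; filterᵇ; allFin)
open import Data.List.Relation.Unary.Linked using (Linked)
open import Data.List.Relation.Unary.All using (All)
open import Data.List.Relation.Unary.Unique.Propositional using (Unique)
open import Data.List.Membership.Propositional using (_∈_; _∉_)
open import Data.Product using (Σ; ∃; ∃-syntax; _×_; _,_)
open import Data.Sum using (_⊎_)
open import Data.Empty using (⊥)
open import Relation.Nullary using (¬_)
open import Relation.Binary.PropositionalEquality using (_≡_; _≢_)

-- Real numbers, as (lower) Dedekind cuts of ℚ.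
-- A real x is represented by its set  L x = { q ∈ ℚ | q < x }.

record ℝ : Set₁ where
  field
    L         : ℚ → Set
    inhabited : ∃[ q ] L q
    lower     : ∀ {p q} → p ≤ℚ q → L q → L p
    rounded   : ∀ {q} → L q → ∃[ r ] (q < r × L r)
    bounded   : ∃[ q ] ¬ L q
open ℝ public

frac : ℕ → ℕ → ℚ
frac x y = (+ x) / suc y

Pos : ℝ → Set
Pos x = L x (frac 0 0)

AtMostOne : ℝ → Set
AtMostOne x = ∀ q → L x q → q < frac 1 0

-- For a natural number d:   c · n^δ ≤ d   (for real c > 0, real δ > 0).
-- Unfolded via rationals:  q · n^(a/b) ≤ d  for all rationals 0 ≤ q < c, 0 ≤ a/b < δ,
-- i.e. with q = x/(y+1), a/b = a/(b+1):  x^(b+1) · n^a ≤ d^(b+1) · (y+1)^(b+1).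
RealPowLe : ℝ → ℝ → ℕ → ℕ → Set
RealPowLe c δ n d =
  ∀ x y a b → L c (frac x y) → L δ (frac a b) →
  x ^ suc b * n ^ a ≤ d ^ suc b * suc y ^ suc b

record Graph (n : ℕ) : Set where
  field
    adj    : Fin n → Fin n → Bool
    sym    : ∀ u v → adj u v ≡ adj v u
    irrefl : ∀ v → adj v v ≡ false
open Graph public

Adj : ∀ {n} → Graph n → Fin n → Fin n → Set
Adj G u v = T (adj G u v)

degree : ∀ {n} → Graph n → Fin n → ℕ
degree {n} G v = length (filterᵇ (adj G v) (allFin n))

data ConnIn {n} (G : Graph n) (S : Fin n → Bool) : Fin n → Fin n → Set where
  here : ∀ {u} → ConnIn G S u u
  step : ∀ {u w v} → Adj G u w → T (S w) → ConnIn G S w v → ConnIn G S u v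

ConnectedSet : ∀ {n} → Graph n → (Fin n → Bool) → Set
ConnectedSet G S = (∃[ v ] T (S v)) × (∀ u v → T (S u) → T (S v) → ConnIn G S u v)

Connected : ∀ {n} → Graph n → Set
Connected {n} G = ∀ (u v : Fin n) → ConnIn G (λ _ → true) u v

-- A K_{2,t} minor model (branch sets): disjoint connected sets A₀,A₁,B₀..B_{t-1}
-- with an edge between A_i and B_j for all i, j.
record K2tModel {n} (G : Graph n) (t : ℕ) : Set where
  field
    A : Fin 2 → Fin n → Bool
    B : Fin t → Fin n → Bool
    A-conn : ∀ i → ConnectedSet G (A i)
    B-conn : ∀ j → ConnectedSet G (B j)
    AA-disj : ∀ i i' v → i ≢ i' → T (A i v) → T (A i' v) → ⊥
    BB-disj : ∀ j j' v → j ≢ j' → T (B j v) → T (B j' v) → ⊥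
    AB-disj : ∀ i j v → T (A i v) → T (B j v) → ⊥
    AB-edge : ∀ i j → ∃[ u ] ∃[ v ] (T (A i u) × T (B j v) × Adj G u v)

K2tMinorFree : ∀ {n} → Graph n → ℕ → Set
K2tMinorFree G t = ¬ K2tModel G t

NonEmpty : ∀ {A : Set} → List A → Set
NonEmpty [] = ⊥
NonEmpty (_ ∷ _) = Data.Unit.⊤
  where import Data.Unit

IsPath : ∀ {n} → Graph n → List (Fin n) → Set
IsPath G p = NonEmpty p × Unique p × Linked (Adj G) p

IsSepPathSystem : ∀ {n} → Graph n → List (List (Fin n)) → Set
IsSepPathSystem {n} G ps =
  All (IsPath G) ps × Unique ps ×
  (∀ (u v : Fin n) → u ≢ v →
     ∃[ p ] (p ∈ ps × ((u ∈ p × v ∉ p) ⊎ (v ∈ p × u ∉ p))))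

module Submission where

-- Cut every path of the system at v₀. The K = 2k pieces avoid v₀ and still separate any two vertices other
-- than v₀, so all neighbours of v₀ but at most one lie on pieces, and along a piece P consecutive neighbours
-- differ in their membership of some piece Q. If that membership fell t times along P (from a vertex of Q to
-- one outside), the stretches of P that start right after a vertex of Q and end at a neighbour of v₀ would be
-- the branch sets of a K_{2,t} minor whose other two branch sets are {v₀} and Q. Rises and falls alternate,
-- so membership in Q changes at most 2t times along P, and deg v₀ ≤ 1 + K(1 + 2tK) = O(t k²). Hence
-- c n^δ ≤ deg v₀ gives k ≥ c′ n^(δ/2) ≥ c′ n^(δ/(t+1)).

open import Data.Bool using (Bool; true; false; T; if_then_else_)
open import Data.Empty using (⊥; ⊥-elim)
open import Data.Fin using (Fin; zero; suc; inject≤; fromℕ<) renaming (_≟_ to _≟ᶠ_)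
open import Data.Fin.Properties using (inject≤-injective)
import Data.Integer as ℤ
open import Data.List
  using (List; []; _∷_; _++_; [_]; length; map; concat; filter; filterᵇ; allFin; lookup; fromMaybe)
open import Data.List.Membership.Propositional using (_∈_; _∉_; find; lose)
open import Data.List.Membership.Propositional.Properties
  using (∈-∃++; ∈-++⁻; ∈-++⁺ˡ; ∈-++⁺ʳ; ∈-filter⁺; ∈-filter⁻; ∈-concat⁺′; ∈-map⁺; ∈-map⁻;
         ∈-lookup)
open import Data.List.Properties using (length-++; length-map)
open import Data.List.Relation.Binary.Disjoint.Propositional using (Disjoint)
import Data.List.Relation.Binary.Disjoint.Propositional.Properties as Disjoint
open import Data.List.Relation.Binary.Subset.Propositional using (_⊆_)
open import Data.List.Relation.Unary.All using (All; []; _∷_)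
import Data.List.Relation.Unary.All as All
import Data.List.Relation.Unary.All.Properties as All
open import Data.List.Relation.Unary.AllPairs using (AllPairs; []; _∷_)
import Data.List.Relation.Unary.AllPairs as AllPairs
open import Data.List.Relation.Unary.Any using (Any; here; there; any?)
open import Data.List.Relation.Unary.Linked using (Linked; []; [-]; _∷_)
open import Data.List.Relation.Unary.Unique.Propositional using (Unique)
import Data.List.Relation.Unary.Unique.Propositional.Properties as Unique
open import Data.Maybe using (Maybe; just; nothing)
import Data.Maybe as Maybe
open import Data.Nat using (ℕ; zero; suc; _+_; _*_; _^_; _≤_; _<_; _<?_; z≤n; s≤s; >-nonZero)
open import Data.Nat.ListAction using (sum)
open import Data.Nat.Properties
open import Data.Nat.Tactic.RingSolver using (solve-∀)
open import Data.Product using (∃-syntax; _×_; _,_; proj₁; proj₂)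
open import Data.Rational using (mkℚ; *<*)
open import Data.Rational.Properties using (↥p/↧p≡p)
open import Data.Sum using (_⊎_; inj₁; inj₂; map₁)
open import Defs hiding (sym)
open import Function using (_∘_)
open import Relation.Binary.Definitions using (DecidableEquality)
open import Relation.Binary.PropositionalEquality using (_≡_; _≢_; refl; sym; trans; cong; subst)
open import Relation.Nullary using (¬_; Dec; yes; no)
open import Relation.Nullary.Decidable using (isYes; toWitness; fromWitness; T?; ¬?)

private variable
  A : Set
  x y : A
  xs ys : List A

Linked-++⁻ˡ : ∀ {R : A → A → Set} xs → Linked R (xs ++ ys) → Linked R xs
Linked-++⁻ˡ []           _       = []
Linked-++⁻ˡ (x ∷ [])     _       = [-]
Linked-++⁻ˡ (x ∷ y ∷ xs) (r ∷ l) = r ∷ Linked-++⁻ˡ (y ∷ xs) l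

Linked-++⁻ʳ : ∀ {R : A → A → Set} xs {ys} → Linked R (xs ++ ys) → Linked R ys
Linked-++⁻ʳ []                     l       = l
Linked-++⁻ʳ (x ∷ [])     {[]}      _       = []
Linked-++⁻ʳ (x ∷ [])     {_ ∷ _}   (_ ∷ l) = l
Linked-++⁻ʳ (x ∷ y ∷ xs)           (_ ∷ l) = Linked-++⁻ʳ (y ∷ xs) l

Unique-++⁻ˡ : ∀ xs → Unique (xs ++ ys) → Unique xs
Unique-++⁻ˡ []       _         = []
Unique-++⁻ˡ (x ∷ xs) (x∉ ∷ u) = All.++⁻ˡ xs x∉ ∷ Unique-++⁻ˡ xs u

Unique-++⁻ʳ : ∀ xs → Unique (xs ++ ys) → Unique ys
Unique-++⁻ʳ []       u       = u
Unique-++⁻ʳ (x ∷ xs) (_ ∷ u) = Unique-++⁻ʳ xs u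

Unique-++⇒Disjoint : ∀ xs → Unique (xs ++ ys) → Disjoint xs ys
Unique-++⇒Disjoint (x ∷ xs) (x∉ ∷ _) (here refl , v∈ys) = All.lookup (All.++⁻ʳ xs x∉) v∈ys refl
Unique-++⇒Disjoint (x ∷ xs) (_ ∷ u)  (there v∈xs , v∈ys) = Unique-++⇒Disjoint xs u (v∈xs , v∈ys)

∈-remove : ∀ xs → y ∈ xs ++ x ∷ ys → y ≢ x → y ∈ xs ++ ys
∈-remove []       (here refl) y≢x = ⊥-elim (y≢x refl)
∈-remove []       (there y∈)  _   = y∈
∈-remove (z ∷ xs) (here refl) _   = here refl
∈-remove (z ∷ xs) (there y∈)  y≢x = there (∈-remove xs y∈ y≢x)

Unique-⊆⇒length-≤ : Unique xs → xs ⊆ ys → length xs ≤ length ys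
Unique-⊆⇒length-≤ {xs = []}     _          _  = z≤n
Unique-⊆⇒length-≤ {xs = x ∷ xs} {ys} (x∉ ∷ u) xs⊆ with ∈-∃++ (xs⊆ (here refl))
... | us , vs , refl = begin
  suc (length xs)             ≤⟨ s≤s (Unique-⊆⇒length-≤ u xs⊆us++vs) ⟩
  suc (length (us ++ vs))     ≡⟨ cong suc (length-++ us) ⟩
  suc (length us + length vs) ≡⟨ sym (+-suc (length us) (length vs)) ⟩
  length us + length (x ∷ vs) ≡⟨ sym (length-++ us) ⟩
  length (us ++ x ∷ vs)       ∎
  where
  open ≤-Reasoning
  xs⊆us++vs : xs ⊆ us ++ vs
  xs⊆us++vs y∈ = ∈-remove us (xs⊆ (there y∈)) (λ { refl → All.lookup x∉ y∈ refl })

Unique-constant⇒length-≤1 : Unique xs → (∀ {x y} → x ∈ xs → y ∈ xs → x ≡ y) → length xs ≤ 1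
Unique-constant⇒length-≤1 []                  _  = z≤n
Unique-constant⇒length-≤1 (_ ∷ [])            _  = s≤s z≤n
Unique-constant⇒length-≤1 ((x≢y ∷ _) ∷ _ ∷ _) eq = ⊥-elim (x≢y (eq (here refl) (there (here refl))))

AllPairs-lookup : ∀ {R : A → A → Set} → (∀ {x y} → R x y → R y x) →
  AllPairs R xs → ∀ {i j} → i ≢ j → R (lookup xs i) (lookup xs j)
AllPairs-lookup R-sym (_ ∷ _)   {zero}  {zero}  i≢j = ⊥-elim (i≢j refl)
AllPairs-lookup R-sym (r ∷ _)   {zero}  {suc j} _   = All.lookup r (∈-lookup j)
AllPairs-lookup R-sym (r ∷ _)   {suc i} {zero}  _   = R-sym (All.lookup r (∈-lookup i))
AllPairs-lookup R-sym (_ ∷ rs)  {suc i} {suc j} i≢j = AllPairs-lookup R-sym rs (i≢j ∘ cong suc)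

∈-fromMaybe⁻ : ∀ {m : Maybe A} → x ∈ fromMaybe m → m ≡ just x
∈-fromMaybe⁻ {m = just x} (here refl) = refl

length-concat : (xss : List (List A)) → length (concat xss) ≡ sum (map length xss)
length-concat []         = refl
length-concat (xs ∷ xss) = trans (length-++ xs) (cong (length xs +_) (length-concat xss))

sum-map-≤ : ∀ (f : A → ℕ) {c} xs → (∀ {x} → x ∈ xs → f x ≤ c) → sum (map f xs) ≤ length xs * c
sum-map-≤ f []       _  = z≤n
sum-map-≤ f (x ∷ xs) f≤ = +-mono-≤ (f≤ (here refl)) (sum-map-≤ f xs (f≤ ∘ there))

falls : List Bool → ℕ
falls (true ∷ false ∷ bs) = suc (falls (false ∷ bs))
falls (_ ∷ bs)            = falls bs
falls []                  = 0

changes : List Bool → ℕ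
changes (true ∷ false ∷ bs) = suc (changes (false ∷ bs))
changes (false ∷ true ∷ bs) = suc (changes (true ∷ bs))
changes (_ ∷ bs)            = changes bs
changes []                  = 0

-- Rises and falls alternate: there is at most one rise more than there are falls, and none more if b is true.
changes-≤-falls : ∀ b bs → changes (b ∷ bs) ≤ 2 * falls (b ∷ bs) + (if b then 0 else 1)
changes-≤-falls true  []           = z≤n
changes-≤-falls false []           = z≤n
changes-≤-falls true  (true ∷ bs)  = changes-≤-falls true bs
changes-≤-falls false (false ∷ bs) = changes-≤-falls false bs
changes-≤-falls true  (false ∷ bs) = begin
  suc (changes (false ∷ bs))            ≤⟨ s≤s (changes-≤-falls false bs) ⟩
  suc (2 * falls (false ∷ bs) + 1)      ≡⟨ cong suc (+-comm (2 * falls (false ∷ bs)) 1) ⟩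
  2 + 2 * falls (false ∷ bs)            ≡⟨ sym (*-suc 2 (falls (false ∷ bs))) ⟩
  2 * suc (falls (false ∷ bs))          ≡⟨ sym (+-identityʳ _) ⟩
  2 * suc (falls (false ∷ bs)) + 0      ∎
  where open ≤-Reasoning
changes-≤-falls false (true ∷ bs) = begin
  suc (changes (true ∷ bs))             ≤⟨ s≤s (changes-≤-falls true bs) ⟩
  suc (2 * falls (true ∷ bs) + 0)       ≡⟨ cong suc (+-identityʳ _) ⟩
  suc (2 * falls (true ∷ bs))           ≡⟨ +-comm 1 _ ⟩
  2 * falls (true ∷ bs) + 1             ∎
  where open ≤-Reasoning

changes≤2*falls+1 : ∀ bs → changes bs ≤ 2 * falls bs + 1
changes≤2*falls+1 []          = z≤n
changes≤2*falls+1 (true ∷ bs) = ≤-trans (changes-≤-falls true bs) (+-monoʳ-≤ _ z≤n)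
changes≤2*falls+1 (false ∷ bs) = changes-≤-falls false bs

changes-∷ : ∀ a b bs → changes (b ∷ bs) ≤ changes (a ∷ b ∷ bs)
changes-∷ true  true  bs = ≤-refl
changes-∷ true  false bs = n≤1+n _
changes-∷ false true  bs = n≤1+n _
changes-∷ false false bs = ≤-refl

changes-≢ : ∀ {a b} bs → a ≢ b → suc (changes (b ∷ bs)) ≤ changes (a ∷ b ∷ bs)
changes-≢ {true}  {true}  _ a≢b = ⊥-elim (a≢b refl)
changes-≢ {true}  {false} _ _   = ≤-refl
changes-≢ {false} {true}  _ _   = ≤-refl
changes-≢ {false} {false} _ a≢b = ⊥-elim (a≢b refl)

Separates : List (A → Bool) → A → A → Set
Separates fs x y = ∃[ f ] (f ∈ fs × f x ≢ f y)

totalChanges : List (A → Bool) → List A → ℕ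
totalChanges fs xs = sum (map (λ f → changes (map f xs)) fs)

totalChanges-∷ : ∀ fs x y (xs : List A) → totalChanges fs (y ∷ xs) ≤ totalChanges fs (x ∷ y ∷ xs)
totalChanges-∷ []       x y xs = z≤n
totalChanges-∷ (f ∷ fs) x y xs = +-mono-≤ (changes-∷ (f x) (f y) (map f xs)) (totalChanges-∷ fs x y xs)

totalChanges-separated : ∀ fs x y (xs : List A) → Separates fs x y →
  suc (totalChanges fs (y ∷ xs)) ≤ totalChanges fs (x ∷ y ∷ xs)
totalChanges-separated (f ∷ fs) x y xs (_ , here refl , fx≢fy) =
  +-mono-≤ (changes-≢ (map f xs) fx≢fy) (totalChanges-∷ fs x y xs)
totalChanges-separated (f ∷ fs) x y xs (g , there g∈ , gx≢gy) = begin
  suc (changes (map f (y ∷ xs)) + totalChanges fs (y ∷ xs)) ≡⟨ sym (+-suc _ _) ⟩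
  changes (map f (y ∷ xs)) + suc (totalChanges fs (y ∷ xs)) ≤⟨ +-mono-≤ (changes-∷ (f x) (f y) (map f xs))
                                                                   (totalChanges-separated fs x y xs (g , g∈ , gx≢gy)) ⟩
  totalChanges (f ∷ fs) (x ∷ y ∷ xs)                         ∎
  where open ≤-Reasoning

length≤1+totalChanges : ∀ fs → Unique xs → (∀ {x y} → x ∈ xs → y ∈ xs → x ≢ y → Separates fs x y) →
  length xs ≤ 1 + totalChanges fs xs
length≤1+totalChanges {xs = []}         fs _ _   = z≤n
length≤1+totalChanges {xs = x ∷ []}     fs _ _   = s≤s z≤n
length≤1+totalChanges {xs = x ∷ y ∷ xs} fs ((x≢y ∷ _) ∷ u) sep = begin
  suc (length (y ∷ xs))              ≤⟨ s≤s (length≤1+totalChanges fs u (λ a b → sep (there a) (there b))) ⟩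
  suc (1 + totalChanges fs (y ∷ xs)) ≤⟨ s≤s (totalChanges-separated fs x y xs
                                              (sep (here refl) (there (here refl)) x≢y)) ⟩
  1 + totalChanges fs (x ∷ y ∷ xs)   ∎
  where open ≤-Reasoning

module _ {A : Set} (_≟_ : DecidableEquality A) where

  before after : A → List A → List A
  before x []       = []
  before x (y ∷ ys) = if isYes (y ≟ x) then [] else y ∷ before x ys
  after  x []       = []
  after  x (y ∷ ys) = if isYes (y ≟ x) then ys else after x ys

  before-after : ∀ x ys → ys ≡ before x ys ++ x ∷ after x ys ⊎ (x ∉ ys × before x ys ≡ ys × after x ys ≡ [])
  before-after x []       = inj₂ ((λ ()) , refl , refl)
  before-after x (y ∷ ys) with y ≟ x
  ... | yes refl = inj₁ refl
  ... | no  y≢x with before-after x ys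
  ...   | inj₁ eq                 = inj₁ (cong (y ∷_) eq)
  ...   | inj₂ (x∉ys , eqᵇ , eqᵃ) = inj₂ (x∉y∷ys , cong (y ∷_) eqᵇ , eqᵃ)
    where
    x∉y∷ys : x ∉ y ∷ ys
    x∉y∷ys (here x≡y)  = y≢x (sym x≡y)
    x∉y∷ys (there x∈ys) = x∉ys x∈ys

  before-⊆ : ∀ x ys → before x ys ⊆ ys
  before-⊆ x (y ∷ ys) v∈ with y ≟ x | v∈
  ... | no _ | here refl = here refl
  ... | no _ | there v∈′ = there (before-⊆ x ys v∈′)

  after-⊆ : ∀ x ys → after x ys ⊆ ys
  after-⊆ x (y ∷ ys) v∈ with y ≟ x
  ... | yes _ = there v∈
  ... | no  _ = there (after-⊆ x ys v∈)

  before-after-cover : ∀ x ys {v} → v ∈ ys → v ≢ x → v ∈ before x ys ⊎ v ∈ after x ys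
  before-after-cover x (y ∷ ys) v∈ v≢x with y ≟ x | v∈
  ... | yes refl | here refl = ⊥-elim (v≢x refl)
  ... | yes refl | there v∈′ = inj₂ v∈′
  ... | no  _    | here refl = inj₁ (here refl)
  ... | no  _    | there v∈′ = map₁ there (before-after-cover x ys v∈′ v≢x)

  pieces : A → List (List A) → List (List A)
  pieces x []       = []
  pieces x (p ∷ ps) = before x p ∷ after x p ∷ pieces x ps

  length-pieces : ∀ x ps → length (pieces x ps) ≡ 2 * length ps
  length-pieces x []       = refl
  length-pieces x (p ∷ ps) = trans (cong (2 +_) (length-pieces x ps)) (sym (*-suc 2 (length ps)))

  ∈-pieces : ∀ x {ps p v} → p ∈ ps → v ∈ p → v ≢ x → ∃[ q ] (q ∈ pieces x ps × v ∈ q × q ⊆ p)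
  ∈-pieces x {p ∷ _} (here refl) v∈p v≢x with before-after-cover x p v∈p v≢x
  ... | inj₁ v∈b = before x p , here refl , v∈b , before-⊆ x p
  ... | inj₂ v∈a = after x p , there (here refl) , v∈a , after-⊆ x p
  ∈-pieces x {_ ∷ _} (there p∈) v∈p v≢x with ∈-pieces x p∈ v∈p v≢x
  ... | q , q∈ , v∈q , q⊆p = q , there (there q∈) , v∈q , q⊆p

-- A gap is a stretch of the list that starts right after a blocked element and ends at the first marked
-- element after it, with no blocked element in between.
module Gaps {A : Set} (blocked marked : A → Bool) where

  markedPrefix : List A → Maybe (List A)
  markedPrefix []       = nothing
  markedPrefix (x ∷ xs) =
    if blocked x then nothing else if marked x then just [ x ] else Maybe.map (x ∷_) (markedPrefix xs)

  gaps : List A → List (List A)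
  gaps []       = []
  gaps (x ∷ xs) = if blocked x then fromMaybe (markedPrefix xs) ++ gaps xs else gaps xs

  markedPrefix-++ : ∀ xs {s} → markedPrefix xs ≡ just s → ∃[ r ] (xs ≡ s ++ r)
  markedPrefix-++ (x ∷ xs) eq with blocked x | marked x | markedPrefix xs in eq′
  markedPrefix-++ (x ∷ xs) refl | false | true  | _      = xs , refl
  markedPrefix-++ (x ∷ xs) refl | false | false | just s with markedPrefix-++ xs eq′
  ... | r , refl = r , refl

  markedPrefix-unblocked : ∀ xs {s} → markedPrefix xs ≡ just s → All (λ a → blocked a ≡ false) s
  markedPrefix-unblocked (x ∷ xs) eq with blocked x in bx | marked x | markedPrefix xs in eq′
  markedPrefix-unblocked (x ∷ xs) refl | false | true  | _      = bx ∷ []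
  markedPrefix-unblocked (x ∷ xs) refl | false | false | just s = bx ∷ markedPrefix-unblocked xs eq′

  markedPrefix-marked : ∀ xs {s} → markedPrefix xs ≡ just s → ∃[ a ] (a ∈ s × T (marked a))
  markedPrefix-marked (x ∷ xs) eq with blocked x | marked x in mx | markedPrefix xs in eq′
  markedPrefix-marked (x ∷ xs) refl | false | true  | _      = x , here refl , subst T (sym mx) _
  markedPrefix-marked (x ∷ xs) refl | false | false | just s with markedPrefix-marked xs eq′
  ... | a , a∈s , ma = a , there a∈s , ma

  gaps-++ : ∀ s {r} → All (λ a → blocked a ≡ false) s → gaps (s ++ r) ≡ gaps r
  gaps-++ []      []         = refl
  gaps-++ (x ∷ s) (bx ∷ bs) rewrite bx = gaps-++ s bs

  ∈-gaps : ∀ xs {s} → s ∈ gaps xs →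
    ∃[ pre ] ∃[ q ] ∃[ r ] (xs ≡ pre ++ q ∷ s ++ r × T (blocked q) × markedPrefix (s ++ r) ≡ just s)
  ∈-gaps (x ∷ xs) s∈ with blocked x in bx
  ... | false with ∈-gaps xs s∈
  ...   | pre , q , r , refl , bq , eq = x ∷ pre , q , r , refl , bq , eq
  ∈-gaps (x ∷ xs) s∈ | true with ∈-++⁻ (fromMaybe (markedPrefix xs)) s∈
  ... | inj₂ s∈′ with ∈-gaps xs s∈′
  ...   | pre , q , r , refl , bq , eq = x ∷ pre , q , r , refl , bq , eq
  ∈-gaps (x ∷ xs) s∈ | true | inj₁ s∈′ with markedPrefix-++ xs (∈-fromMaybe⁻ s∈′)
  ... | r , refl = [] , x , r , refl , subst T (sym bx) _ , ∈-fromMaybe⁻ s∈′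

  gaps-⊆ : ∀ xs {s} → s ∈ gaps xs → s ⊆ xs
  gaps-⊆ xs s∈ v∈s with ∈-gaps xs s∈
  ... | pre , q , r , refl , _ = ∈-++⁺ʳ pre (there (∈-++⁺ˡ v∈s))

  gaps-disjoint : ∀ xs → Unique xs → AllPairs Disjoint (gaps xs)
  gaps-disjoint []       _       = []
  gaps-disjoint (x ∷ xs) (_ ∷ u) with blocked x
  ... | false = gaps-disjoint xs u
  ... | true with markedPrefix xs in eq
  ...   | nothing = gaps-disjoint xs u
  ...   | just s with markedPrefix-++ xs eq
  ...     | r , refl = All.tabulate s#gap ∷ gaps-disjoint (s ++ r) u
    where
    s#gap : ∀ {s′} → s′ ∈ gaps (s ++ r) → Disjoint s s′
    s#gap s′∈ (v∈s , v∈s′) =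
      Unique-++⇒Disjoint s u
        (v∈s , gaps-⊆ r (subst (_ ∈_) (gaps-++ s (markedPrefix-unblocked (s ++ r) eq)) s′∈) v∈s′)

  flags : List A → List Bool
  flags xs = map blocked (filterᵇ marked xs)

  -- Each fall of blocked along the marked elements happens inside its own gap.
  mutual
    falls-≤-gaps : ∀ xs → falls (flags xs) ≤ length (gaps xs)
    falls-≤-gaps []       = z≤n
    falls-≤-gaps (x ∷ xs) with marked x
    ... | true  with blocked x
    ...   | true  = falls-after-blocked xs
    ...   | false = falls-≤-gaps xs
    falls-≤-gaps (x ∷ xs) | false with blocked x
    ...   | true  = ≤-trans (falls-≤-gaps xs)
                       (≤-trans (m≤n+m _ _) (≤-reflexive (sym (length-++ (fromMaybe (markedPrefix xs))))))
    ...   | false = falls-≤-gaps xs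

    falls-after-blocked : ∀ xs → falls (true ∷ flags xs) ≤ length (fromMaybe (markedPrefix xs) ++ gaps xs)
    falls-after-blocked []       = z≤n
    falls-after-blocked (x ∷ xs) with marked x
    ... | true  with blocked x
    ...   | true  = falls-after-blocked xs
    ...   | false = s≤s (falls-≤-gaps xs)
    falls-after-blocked (x ∷ xs) | false with blocked x
    ...   | true  = falls-after-blocked xs
    ...   | false with markedPrefix xs | falls-after-blocked xs
    ...     | nothing | ih = ih
    ...     | just _  | ih = ih

module _ {n : ℕ} (G : Graph n) where
  open import Data.List.Membership.DecPropositional (_≟ᶠ_ {n}) using (_∈?_)

  _∈ᵇ_ : Fin n → List (Fin n) → Bool
  v ∈ᵇ p = isYes (v ∈? p)

  ∈ᵇ⇒∈ : ∀ {v p} → T (v ∈ᵇ p) → v ∈ p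
  ∈ᵇ⇒∈ = toWitness

  ∈⇒∈ᵇ : ∀ {v p} → v ∈ p → T (v ∈ᵇ p)
  ∈⇒∈ᵇ = fromWitness

  ∈ᵇ≡false⇒∉ : ∀ {v p} → v ∈ᵇ p ≡ false → v ∉ p
  ∈ᵇ≡false⇒∉ eq v∈p = subst T eq (∈⇒∈ᵇ v∈p)

  ∈ᵇ-separates : ∀ {u v p} → u ∈ p → v ∉ p → u ∈ᵇ p ≢ v ∈ᵇ p
  ∈ᵇ-separates u∈p v∉p eq = v∉p (∈ᵇ⇒∈ (subst T eq (∈⇒∈ᵇ u∈p)))

  Adj-sym : ∀ {u v} → Adj G u v → Adj G v u
  Adj-sym {u} {v} = subst T (Graph.sym G u v)

  Adj-irrefl : ∀ {u v} → Adj G u v → u ≢ v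
  Adj-irrefl {u} a refl = subst T (Graph.irrefl G u) a

  neighbours : Fin n → List (Fin n) → List (Fin n)
  neighbours v = filterᵇ (adj G v)

  ∈-neighbours⁻ : ∀ {v} p {w} → w ∈ neighbours v p → w ∈ p × Adj G v w
  ∈-neighbours⁻ {v} p = ∈-filter⁻ (T? ∘ adj G v) {xs = p}

  ∈-neighbours⁺ : ∀ {v p w} → w ∈ p → Adj G v w → w ∈ neighbours v p
  ∈-neighbours⁺ {v} = ∈-filter⁺ (T? ∘ adj G v)

  neighbours-unique : ∀ v {p} → Unique p → Unique (neighbours v p)
  neighbours-unique v = Unique.filter⁺ (T? ∘ adj G v)

  neighbour≢ : ∀ {v} p {w} → w ∈ neighbours v p → w ≢ v
  neighbour≢ p w∈ refl = Adj-irrefl (proj₂ (∈-neighbours⁻ p w∈)) refl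

  module _ {S : Fin n → Bool} where

    ConnIn-snoc : ∀ {u w v} → ConnIn G S u w → Adj G w v → T (S v) → ConnIn G S u v
    ConnIn-snoc here         a′ sv = step a′ sv here
    ConnIn-snoc (step a s c) a′ sv = step a s (ConnIn-snoc c a′ sv)

    ConnIn-trans : ∀ {u w v} → ConnIn G S u w → ConnIn G S w v → ConnIn G S u v
    ConnIn-trans here         c′ = c′
    ConnIn-trans (step a s c) c′ = step a s (ConnIn-trans c c′)

    ConnIn-sym : ∀ {u v} → T (S u) → ConnIn G S u v → ConnIn G S v u
    ConnIn-sym su here         = here
    ConnIn-sym su (step a s c) = ConnIn-snoc (ConnIn-sym s c) (Adj-sym a) su

  Linked⇒ConnIn : ∀ {S x xs v} → Linked (Adj G) (x ∷ xs) → All (T ∘ S) xs → v ∈ x ∷ xs → ConnIn G S x v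
  Linked⇒ConnIn _       _        (here refl) = here
  Linked⇒ConnIn (a ∷ l) (s ∷ ss) (there v∈)  = step a s (Linked⇒ConnIn l ss v∈)

  Linked⇒ConnectedSet : ∀ {p v} → Linked (Adj G) p → v ∈ p → ConnectedSet G (_∈ᵇ p)
  Linked⇒ConnectedSet {x ∷ xs} {v} l v∈ = (v , ∈⇒∈ᵇ v∈) , λ u w su sw →
    ConnIn-trans (ConnIn-sym (∈⇒∈ᵇ (here refl)) (from-head (∈ᵇ⇒∈ su))) (from-head (∈ᵇ⇒∈ sw))
    where
    from-head : ∀ {u} → u ∈ x ∷ xs → ConnIn G (_∈ᵇ (x ∷ xs)) x u
    from-head = Linked⇒ConnIn l (All.tabulate (∈⇒∈ᵇ ∘ there))

  K2tModel-≤ : ∀ {s t} → s ≤ t → K2tModel G t → K2tModel G s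
  K2tModel-≤ s≤t model = record
    { A = M.A ; B = λ j → M.B (inject≤ j s≤t) ; A-conn = M.A-conn ; B-conn = λ j → M.B-conn (inject≤ j s≤t)
    ; AA-disj = M.AA-disj
    ; BB-disj = λ j j′ v j≢j′ → M.BB-disj _ _ v (j≢j′ ∘ inject≤-injective s≤t s≤t j j′)
    ; AB-disj = λ i j → M.AB-disj i (inject≤ j s≤t)
    ; AB-edge = λ i j → M.AB-edge i (inject≤ j s≤t)
    }
    where module M = K2tModel model

  record Spoke (v₀ : Fin n) (Q s : List (Fin n)) : Set where
    field
      linked    : Linked (Adj G) s
      avoids-v₀ : v₀ ∉ s
      avoids-Q  : Disjoint s Q
      meets-N   : ∃[ w ] (w ∈ s × Adj G v₀ w)
      meets-Q   : ∃[ q ] ∃[ w ] (q ∈ Q × w ∈ s × Adj G q w)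

  fan⇒K2tModel : ∀ {v₀ Q q} → Linked (Adj G) Q → v₀ ∉ Q → q ∈ Q →
    (ss : List (List (Fin n))) → All (Spoke v₀ Q) ss → AllPairs Disjoint ss → K2tModel G (length ss)
  fan⇒K2tModel {v₀} {Q} {q} linkedQ v₀∉Q q∈Q ss spokes disjoint = record
    { A = left ; B = right ; A-conn = A-conn ; B-conn = B-conn
    ; AA-disj = AA-disj ; BB-disj = BB-disj ; AB-disj = AB-disj ; AB-edge = AB-edge }
    where
    spoke : ∀ j → Spoke v₀ Q (lookup ss j)
    spoke j = All.lookup spokes (∈-lookup j)

    left : Fin 2 → Fin n → Bool
    left zero       = _∈ᵇ [ v₀ ]
    left (suc zero) = _∈ᵇ Q

    right : Fin (length ss) → Fin n → Bool
    right j = _∈ᵇ lookup ss j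

    A-conn : ∀ i → ConnectedSet G (left i)
    A-conn zero       = Linked⇒ConnectedSet [-] (here refl)
    A-conn (suc zero) = Linked⇒ConnectedSet linkedQ q∈Q

    B-conn : ∀ j → ConnectedSet G (right j)
    B-conn j = Linked⇒ConnectedSet (Spoke.linked (spoke j)) (proj₁ (proj₂ (Spoke.meets-N (spoke j))))

    AA-disj : ∀ i i′ v → i ≢ i′ → T (left i v) → T (left i′ v) → ⊥
    AA-disj zero       zero       _ i≢i′ _ _ = i≢i′ refl
    AA-disj (suc zero) (suc zero) _ i≢i′ _ _ = i≢i′ refl
    AA-disj zero       (suc zero) _ _ v∈ v∈Q with ∈ᵇ⇒∈ v∈
    ... | here refl = v₀∉Q (∈ᵇ⇒∈ v∈Q)
    AA-disj (suc zero) zero       _ _ v∈Q v∈ with ∈ᵇ⇒∈ v∈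
    ... | here refl = v₀∉Q (∈ᵇ⇒∈ v∈Q)

    BB-disj : ∀ j j′ v → j ≢ j′ → T (right j v) → T (right j′ v) → ⊥
    BB-disj j j′ v j≢j′ v∈ v∈′ =
      AllPairs-lookup Disjoint.sym disjoint j≢j′ (∈ᵇ⇒∈ v∈ , ∈ᵇ⇒∈ v∈′)

    AB-disj : ∀ i j v → T (left i v) → T (right j v) → ⊥
    AB-disj zero       j v v∈ v∈s with ∈ᵇ⇒∈ v∈
    ... | here refl = Spoke.avoids-v₀ (spoke j) (∈ᵇ⇒∈ v∈s)
    AB-disj (suc zero) j v v∈Q v∈s = Spoke.avoids-Q (spoke j) (∈ᵇ⇒∈ v∈s , ∈ᵇ⇒∈ v∈Q)

    AB-edge : ∀ i j → ∃[ u ] ∃[ v ] (T (left i u) × T (right j v) × Adj G u v)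
    AB-edge zero j with Spoke.meets-N (spoke j)
    ... | w , w∈s , a = v₀ , w , ∈⇒∈ᵇ (here refl) , ∈⇒∈ᵇ w∈s , a
    AB-edge (suc zero) j with Spoke.meets-Q (spoke j)
    ... | q′ , w , q′∈Q , w∈s , a = q′ , w , ∈⇒∈ᵇ q′∈Q , ∈⇒∈ᵇ w∈s , a

  PathAvoiding : Fin n → List (Fin n) → Set
  PathAvoiding v p = Linked (Adj G) p × Unique p × v ∉ p

  SeparatingFamily : Fin n → List (List (Fin n)) → Set
  SeparatingFamily v₀ Qs = ∀ {u v} → u ≢ v₀ → v ≢ v₀ → u ≢ v →
    ∃[ Q ] (Q ∈ Qs × ((u ∈ Q × v ∉ Q) ⊎ (v ∈ Q × u ∉ Q)))

  halves-avoid : ∀ v₀ {p} → Linked (Adj G) p → Unique p →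
    PathAvoiding v₀ (before _≟ᶠ_ v₀ p) × PathAvoiding v₀ (after _≟ᶠ_ v₀ p)
  halves-avoid v₀ {p} linked unique with before-after _≟ᶠ_ v₀ p
  ... | inj₂ (v₀∉p , eqᵇ , eqᵃ) rewrite eqᵇ | eqᵃ = (linked , unique , v₀∉p) , ([] , [] , λ ())
  ... | inj₁ eq =
      (Linked-++⁻ˡ b linked′ , Unique-++⁻ˡ b unique′ , λ v₀∈b → Unique-++⇒Disjoint b unique′ (v₀∈b , here refl))
    , (Linked-++⁻ʳ [ v₀ ] (Linked-++⁻ʳ b linked′) , AllPairs.tail unique-v₀a ,
       λ v₀∈a → All.lookup (AllPairs.head unique-v₀a) v₀∈a refl)
    where
    b a : List (Fin n)
    b = before _≟ᶠ_ v₀ p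
    a = after _≟ᶠ_ v₀ p
    linked′ : Linked (Adj G) (b ++ v₀ ∷ a)
    linked′ = subst (Linked (Adj G)) eq linked
    unique′ : Unique (b ++ v₀ ∷ a)
    unique′ = subst Unique eq unique
    unique-v₀a : Unique (v₀ ∷ a)
    unique-v₀a = Unique-++⁻ʳ b unique′

  pieces-avoid : ∀ v₀ {ps} → All (IsPath G) ps → All (PathAvoiding v₀) (pieces _≟ᶠ_ v₀ ps)
  pieces-avoid v₀ []                              = []
  pieces-avoid v₀ ((_ , unique , linked) ∷ paths) with halves-avoid v₀ linked unique
  ... | beforeAvoids , afterAvoids = beforeAvoids ∷ afterAvoids ∷ pieces-avoid v₀ paths

  pieces-separating : ∀ v₀ {ps} → IsSepPathSystem G ps → SeparatingFamily v₀ (pieces _≟ᶠ_ v₀ ps)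
  pieces-separating v₀ (_ , _ , separates) {u} {v} u≢v₀ v≢v₀ u≢v with separates u v u≢v
  ... | p , p∈ , inj₁ (u∈p , v∉p) with ∈-pieces _≟ᶠ_ v₀ p∈ u∈p u≢v₀
  ...   | Q , Q∈ , u∈Q , Q⊆p = Q , Q∈ , inj₁ (u∈Q , v∉p ∘ Q⊆p)
  pieces-separating v₀ (_ , _ , separates) {u} {v} u≢v₀ v≢v₀ u≢v | p , p∈ , inj₂ (v∈p , u∉p)
    with ∈-pieces _≟ᶠ_ v₀ p∈ v∈p v≢v₀
  ...   | Q , Q∈ , v∈Q , Q⊆p = Q , Q∈ , inj₂ (v∈Q , u∉p ∘ Q⊆p)

  module _ {v₀ : Fin n} {Q : List (Fin n)} where
    open Gaps (_∈ᵇ Q) (adj G v₀)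

    gap-spoke : ∀ P → Linked (Adj G) P → v₀ ∉ P → ∀ {s} → s ∈ gaps P → Spoke v₀ Q s
    gap-spoke P linkedP v₀∉P {s} s∈ with ∈-gaps P s∈
    ... | pre , q , r , refl , q∈Q , prefix = record
      { linked    = Linked-++⁻ʳ [ q ] linked-qs
      ; avoids-v₀ = v₀∉P ∘ gaps-⊆ P s∈
      ; avoids-Q  = λ (v∈s , v∈Q) → ∈ᵇ≡false⇒∉ (All.lookup (markedPrefix-unblocked (s ++ r) prefix) v∈s) v∈Q
      ; meets-N   = markedPrefix-marked (s ++ r) prefix
      ; meets-Q   = q , edge-from-q linked-qs (proj₁ (proj₂ (markedPrefix-marked (s ++ r) prefix)))
      }
      where
      linked-qs : Linked (Adj G) (q ∷ s)
      linked-qs = Linked-++⁻ˡ (q ∷ s) (Linked-++⁻ʳ pre linkedP)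
      edge-from-q : ∀ {s v} → Linked (Adj G) (q ∷ s) → v ∈ s → ∃[ w ] (q ∈ Q × w ∈ s × Adj G q w)
      edge-from-q [-]     ()
      edge-from-q (a ∷ _) _ = _ , ∈ᵇ⇒∈ q∈Q , here refl , a

    gaps<t : ∀ {t P} → 1 ≤ t → K2tMinorFree G t → PathAvoiding v₀ P → Linked (Adj G) Q → v₀ ∉ Q →
      length (gaps P) < t
    gaps<t {t} {P} 1≤t minorFree (linkedP , uniqueP , v₀∉P) linkedQ v₀∉Q with length (gaps P) <? t
    ... | yes g<t = g<t
    ... | no  g≮t = ⊥-elim (minorFree (K2tModel-≤ t≤g (gaps-model (≤-trans 1≤t t≤g))))
      where
      t≤g : t ≤ length (gaps P)
      t≤g = ≮⇒≥ g≮t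
      spokes : All (Spoke v₀ Q) (gaps P)
      spokes = All.tabulate (gap-spoke P linkedP v₀∉P)
      gaps-model : 1 ≤ length (gaps P) → K2tModel G (length (gaps P))
      gaps-model 1≤g with Spoke.meets-Q (All.lookup spokes (∈-lookup (fromℕ< 1≤g)))
      ... | _ , _ , q∈Q , _ = fan⇒K2tModel linkedQ v₀∉Q q∈Q (gaps P) spokes (gaps-disjoint P uniqueP)

    changes≤2*t : ∀ {t P} → 1 ≤ t → K2tMinorFree G t → PathAvoiding v₀ P → PathAvoiding v₀ Q →
      changes (map (_∈ᵇ Q) (neighbours v₀ P)) ≤ 2 * t
    changes≤2*t {t} {P} 1≤t minorFree pathP (linkedQ , _ , v₀∉Q) = begin
      changes (flags P)           ≤⟨ changes≤2*falls+1 (flags P) ⟩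
      2 * falls (flags P) + 1     ≤⟨ +-monoˡ-≤ 1 (*-monoʳ-≤ 2 (falls-≤-gaps P)) ⟩
      2 * length (gaps P) + 1     ≡⟨ +-comm _ 1 ⟩
      suc (2 * length (gaps P))   ≤⟨ n≤1+n _ ⟩
      2 + 2 * length (gaps P)     ≡⟨ sym (*-suc 2 _) ⟩
      2 * suc (length (gaps P))   ≤⟨ *-monoʳ-≤ 2 (gaps<t 1≤t minorFree pathP linkedQ v₀∉Q) ⟩
      2 * t                       ∎
      where open ≤-Reasoning

  module _ {t : ℕ} {v₀ : Fin n} (1≤t : 1 ≤ t) (minorFree : K2tMinorFree G t)
           (Qs : List (List (Fin n))) (paths : All (PathAvoiding v₀) Qs) (separating : SeparatingFamily v₀ Qs)
           where

    indicators : List (Fin n → Bool)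
    indicators = map (λ Q v → v ∈ᵇ Q) Qs

    indicators-separate : ∀ {u v} → u ≢ v₀ → v ≢ v₀ → u ≢ v → Separates indicators u v
    indicators-separate u≢v₀ v≢v₀ u≢v with separating u≢v₀ v≢v₀ u≢v
    ... | Q , Q∈ , inj₁ (u∈Q , v∉Q) = _ , ∈-map⁺ _ Q∈ , ∈ᵇ-separates u∈Q v∉Q
    ... | Q , Q∈ , inj₂ (v∈Q , u∉Q) = _ , ∈-map⁺ _ Q∈ , ∈ᵇ-separates v∈Q u∉Q ∘ sym

    neighbours-in-piece-≤ : ∀ {P} → P ∈ Qs → length (neighbours v₀ P) ≤ 1 + length Qs * (2 * t)
    neighbours-in-piece-≤ {P} P∈ = begin
      length (neighbours v₀ P)                      ≤⟨ length≤1+totalChanges indicators unique separated ⟩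
      1 + totalChanges indicators (neighbours v₀ P) ≤⟨ s≤s (sum-map-≤ _ indicators changes-≤) ⟩
      1 + length indicators * (2 * t)               ≡⟨ cong (λ k → 1 + k * (2 * t)) (length-map _ Qs) ⟩
      1 + length Qs * (2 * t)                       ∎
      where
      open ≤-Reasoning
      unique : Unique (neighbours v₀ P)
      unique = neighbours-unique v₀ (proj₁ (proj₂ (All.lookup paths P∈)))
      separated : ∀ {u v} → u ∈ neighbours v₀ P → v ∈ neighbours v₀ P → u ≢ v → Separates indicators u v
      separated u∈ v∈ = indicators-separate (neighbour≢ P u∈) (neighbour≢ P v∈)
      changes-≤ : ∀ {f} → f ∈ indicators → changes (map f (neighbours v₀ P)) ≤ 2 * t
      changes-≤ f∈ with ∈-map⁻ _ f∈
      ... | Q , Q∈ , refl = changes≤2*t 1≤t minorFree (All.lookup paths P∈) (All.lookup paths Q∈)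

    uncovered? : ∀ v → Dec (¬ Any (v ∈_) Qs)
    uncovered? v = ¬? (any? (v ∈?_) Qs)

    uncovered : List (Fin n)
    uncovered = filter uncovered? (neighbours v₀ (allFin n))

    uncovered-≤1 : length uncovered ≤ 1
    uncovered-≤1 = Unique-constant⇒length-≤1
      (Unique.filter⁺ uncovered? (neighbours-unique v₀ (Unique.allFin⁺ n))) equal
      where
      equal : ∀ {x y} → x ∈ uncovered → y ∈ uncovered → x ≡ y
      equal {x} {y} x∈ y∈ with x ≟ᶠ y
      ... | yes x≡y = x≡y
      ... | no  x≢y
        with ∈-filter⁻ uncovered? {xs = neighbours v₀ (allFin n)} x∈
           | ∈-filter⁻ uncovered? {xs = neighbours v₀ (allFin n)} y∈
      ... | x∈N , x-uncovered | y∈N , y-uncovered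
        with separating (neighbour≢ (allFin n) x∈N) (neighbour≢ (allFin n) y∈N) x≢y
      ... | Q , Q∈ , inj₁ (x∈Q , _) = ⊥-elim (x-uncovered (lose Q∈ x∈Q))
      ... | Q , Q∈ , inj₂ (y∈Q , _) = ⊥-elim (y-uncovered (lose Q∈ y∈Q))

    covered : List (Fin n)
    covered = concat (map (neighbours v₀) Qs)

    covered-≤ : length covered ≤ length Qs * (1 + length Qs * (2 * t))
    covered-≤ = begin
      length covered                            ≡⟨ length-concat (map (neighbours v₀) Qs) ⟩
      sum (map length (map (neighbours v₀) Qs)) ≤⟨ sum-map-≤ length (map (neighbours v₀) Qs) piece-≤ ⟩
      length (map (neighbours v₀) Qs) * bound   ≡⟨ cong (_* bound) (length-map (neighbours v₀) Qs) ⟩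
      length Qs * bound                         ∎
      where
      open ≤-Reasoning
      bound : ℕ
      bound = 1 + length Qs * (2 * t)
      piece-≤ : ∀ {xs} → xs ∈ map (neighbours v₀) Qs → length xs ≤ bound
      piece-≤ xs∈ with ∈-map⁻ (neighbours v₀) xs∈
      ... | P , P∈ , refl = neighbours-in-piece-≤ P∈

    neighbours-⊆ : neighbours v₀ (allFin n) ⊆ uncovered ++ covered
    neighbours-⊆ {v} v∈N with any? (v ∈?_) Qs
    ... | no  v-uncovered = ∈-++⁺ˡ (∈-filter⁺ uncovered? v∈N v-uncovered)
    ... | yes v-covered with find v-covered
    ...   | Q , Q∈ , v∈Q = ∈-++⁺ʳ uncovered
              (∈-concat⁺′ (∈-neighbours⁺ v∈Q (proj₂ (∈-neighbours⁻ (allFin n) v∈N))) (∈-map⁺ (neighbours v₀) Q∈))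

    degree-≤ : degree G v₀ ≤ 1 + length Qs * (1 + length Qs * (2 * t))
    degree-≤ = begin
      length (neighbours v₀ (allFin n)) ≤⟨ Unique-⊆⇒length-≤ (neighbours-unique v₀ (Unique.allFin⁺ n)) neighbours-⊆ ⟩
      length (uncovered ++ covered)     ≡⟨ length-++ uncovered ⟩
      length uncovered + length covered ≤⟨ +-mono-≤ uncovered-≤1 covered-≤ ⟩
      1 + length Qs * (1 + length Qs * (2 * t)) ∎
      where open ≤-Reasoning

  degree-≤-pathSystem : ∀ {t} v₀ {ps} → 1 ≤ t → K2tMinorFree G t → IsSepPathSystem G ps →
    degree G v₀ ≤ 1 + 2 * length ps * (1 + 2 * length ps * (2 * t))
  degree-≤-pathSystem {t} v₀ {ps} 1≤t minorFree system =
    subst (λ K → degree G v₀ ≤ 1 + K * (1 + K * (2 * t))) (length-pieces _≟ᶠ_ v₀ ps)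
      (degree-≤ 1≤t minorFree (pieces _≟ᶠ_ v₀ ps)
        (pieces-avoid v₀ (proj₁ system)) (pieces-separating v₀ system))

pathSystem-nonempty : ∀ {n} {G : Graph n} {ps} → 2 ≤ n → IsSepPathSystem G ps → 1 ≤ length ps
pathSystem-nonempty {ps = _ ∷ _} _ _ = s≤s z≤n
pathSystem-nonempty {ps = []} (s≤s (s≤s _)) (_ , _ , separates) with separates zero (suc zero) (λ ())
... | _ , () , _

*-^-distrib : ∀ p q e → (p * q) ^ e ≡ p ^ e * q ^ e
*-^-distrib p q zero    = refl
*-^-distrib p q (suc e) = trans (cong (p * q *_) (*-^-distrib p q e)) (interchange p q (p ^ e) (q ^ e))
  where
  interchange : ∀ p q r s → p * q * (r * s) ≡ p * r * (q * s)
  interchange = solve-∀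

quadratic-≤ : ∀ t k → 1 ≤ k → 1 + 2 * k * (1 + 2 * k * (2 * t)) ≤ (1 + 2 * t) * (3 * k * (3 * k))
quadratic-≤ t k 1≤k = begin
  1 + K * (1 + K * (2 * t))                                      ≤⟨ m≤m+n _ _ ⟩
  1 + K * (1 + K * (2 * t)) + (K + K * K + 2 * t + 4 * t * K)     ≡⟨ sym (expand K t) ⟩
  (1 + 2 * t) * ((1 + K) * (1 + K))                               ≤⟨ *-monoʳ-≤ (1 + 2 * t) (*-mono-≤ 1+K≤3k 1+K≤3k) ⟩
  (1 + 2 * t) * (3 * k * (3 * k))                                 ∎
  where
  open ≤-Reasoning
  K : ℕ
  K = 2 * k
  1+K≤3k : 1 + K ≤ 3 * k
  1+K≤3k = +-monoˡ-≤ K 1≤k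
  expand : ∀ K t → (1 + 2 * t) * ((1 + K) * (1 + K)) ≡ 1 + K * (1 + K * (2 * t)) + (K + K * K + 2 * t + 4 * t * K)
  expand = solve-∀

power-bound : ∀ t k d m y a b N → 1 ≤ t → 1 ≤ k → d ≤ (1 + 2 * t) * (3 * k * (3 * k)) →
  suc m ^ suc b * N ^ a ≤ d ^ suc b * suc y ^ suc b →
  1 ^ (suc b * (t + 1)) * N ^ a ≤ k ^ (suc b * (t + 1)) * (3 * (1 + 2 * t) * suc y) ^ (suc b * (t + 1))
power-bound t k d m y a b N 1≤t 1≤k d≤ hyp = begin
  1 ^ E * N ^ a          ≡⟨ cong (_* N ^ a) (^-zeroˡ E) ⟩
  1 * N ^ a              ≤⟨ *-monoˡ-≤ (N ^ a) (m^n>0 (suc m) (suc b)) ⟩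
  suc m ^ suc b * N ^ a  ≤⟨ hyp ⟩
  d ^ suc b * s ^ suc b  ≡⟨ sym (*-^-distrib d s (suc b)) ⟩
  (d * s) ^ suc b        ≤⟨ ^-monoˡ-≤ (suc b) ds≤zz ⟩
  (z * z) ^ suc b        ≡⟨ *-^-distrib z z (suc b) ⟩
  z ^ suc b * z ^ suc b  ≡⟨ sym (^-distribˡ-+-* z (suc b) (suc b)) ⟩
  z ^ (suc b + suc b)    ≤⟨ ^-monoʳ-≤ z {{>-nonZero 1≤z}} 2b≤E ⟩
  z ^ E                  ≡⟨ *-^-distrib k Y E ⟩
  k ^ E * Y ^ E          ∎
  where
  open ≤-Reasoning
  E s u Y z : ℕ
  E = suc b * (t + 1)
  s = suc y
  u = 1 + 2 * t
  Y = 3 * u * s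
  z = k * Y
  1≤z : 1 ≤ z
  1≤z = *-mono-≤ 1≤k (s≤s z≤n)
  square : ∀ t k s → (1 + 2 * t) * (3 * k * (3 * k)) * s * ((1 + 2 * t) * s)
                   ≡ k * (3 * (1 + 2 * t) * s) * (k * (3 * (1 + 2 * t) * s))
  square = solve-∀
  ds≤zz : d * s ≤ z * z
  ds≤zz = begin
    d * s                                  ≤⟨ *-monoˡ-≤ s d≤ ⟩
    u * (3 * k * (3 * k)) * s              ≤⟨ m≤m*n _ (u * s) ⟩
    u * (3 * k * (3 * k)) * s * (u * s)    ≡⟨ square t k s ⟩
    z * z                                  ∎
  2b≤E : suc b + suc b ≤ E
  2b≤E = begin
    suc b + suc b  ≡⟨ cong (suc b +_) (sym (+-identityʳ (suc b))) ⟩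
    2 * suc b      ≡⟨ *-comm 2 (suc b) ⟩
    suc b * 2      ≤⟨ *-monoʳ-≤ (suc b) (+-monoˡ-≤ 1 1≤t) ⟩
    E              ∎

positive-fraction-below : (c : ℝ) → Pos c → ∃[ m ] ∃[ y ] L c (frac (suc m) y)
positive-fraction-below c c>0 with rounded c c>0
... | r@(mkℚ (ℤ.+ suc m) y _) , _ , c>r = m , y , subst (L c) (sym (↥p/↧p≡p r)) c>r
... | mkℚ (ℤ.+ zero)  _ _ , *<* (ℤ.+<+ ()) , _
... | mkℚ ℤ.-[1+ _ ]  _ _ , *<* ()         , _

theorem18 : (t : ℕ) → 1 ≤ t → (δ c : ℝ) → Pos δ → AtMostOne δ → Pos c →
    ∃[ X ] ∃[ Y ] (1 ≤ X × 1 ≤ Y ×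
    ((n : ℕ) (G : Graph n) → 4 ≤ n → Connected G → K2tMinorFree G t →
    (v₀ : Fin n) → RealPowLe c δ n (degree G v₀) →
    (ps : List (List (Fin n))) → IsSepPathSystem G ps →
    ∀ a b → L δ (frac a b) →
    X ^ (suc b * (t + 1)) * n ^ a ≤ length ps ^ (suc b * (t + 1)) * Y ^ (suc b * (t + 1))))
theorem18 t 1≤t δ c _ _ c>0 with positive-fraction-below c c>0
... | m , y , c>q = 1 , 3 * (1 + 2 * t) * suc y , ≤-refl , s≤s z≤n ,
  λ n G 4≤n _ minorFree v₀ degree≥ ps system a b δ>a/b →
    let 1≤k : 1 ≤ length ps
        1≤k = pathSystem-nonempty {G = G} (≤-trans (s≤s (s≤s z≤n)) 4≤n) system
    in power-bound t (length ps) (degree G v₀) m y a b n 1≤t 1≤k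
         (≤-trans (degree-≤-pathSystem G v₀ 1≤t minorFree system) (quadratic-≤ t (length ps) 1≤k))
         (degree≥ (suc m) y a b c>q δ>a/b)
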